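{- Let $F$ be a fork with point of return $r$, and let $v_1\prec v_2\prec\dots\prec v_{n-1}$ be the unique acyclic ordering of $F\setminus\{r\}$. For a vertex $v_j$, let $F'=\mu_{v_j}(F)$. If $r\to v_j$ in $F$, then $F'\setminus\{v_j\}$ has the unique acyclic ordering $r\prec v_1\prec\dots\prec v_{j-1}\prec v_{j+1}\prec\dots\prec v_{n-1}$. If instead $v_j\to r$ in $F$, then $F'\setminus\{v_j\}$ has the unique acyclic ordering $v_1\prec\dots\prec v_{j-1}\prec v_{j+1}\prec\dots\prec v_{n-1}\prec r$.
   Context: A quiver is a finite directed multigraph without loops or 2-cycles; $f_{ij}$ is the number of arrows $i\to j$, taken negative if arrows go $j\to i$. Mutation at $k$: add an arrow $a\to b$ for each path $a\to k\to b$, reverse all arrows at $k$, remove 2-cycles. For a vertex set $V$, $F\setminus V$ denotes the full subquiver on the remaining vertices. Abundant: at least two arrows between every pair of distinct vertices; acyclic: no directed cycle. An acyclic ordering is a total order $\prec$ on the vertices with $v_i\prec v_j$ whenever there is an arrow $v_i\to v_j$. A fork is an abundant, non-acyclic quiver $F$ with a vertex $r$ (point of return) such that for all $i\in F^-(r)$ (vertices with arrows to $r$) and $j\in F^+(r)$ (vertices with arrows from $r$), $f_{ji}>f_{ir}$ and $f_{ji}>f_{rj}$, and $F\setminus\{r\}$ is acyclic. -}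

module Defs where

open import Data.Nat using (ℕ)
open import Data.Integer using (ℤ; 0ℤ; _+_; _-_; _*_; -_; _<_; _≤_; ∣_∣; +_)
import Data.Nat as ℕ
open import Data.Fin as Fin using (Fin)
open import Data.Fin.Properties using (_≟_)
open import Data.List using (List; length; lookup)
open import Data.List.Membership.Propositional using (_∈_)
open import Data.List.Relation.Unary.Unique.Propositional using (Unique)
open import Data.Product using (_×_; Σ)
open import Data.Sum using (_⊎_)
open import Data.Bool using (if_then_else_)
open import Relation.Nullary using (¬_; Dec; yes; no)
open import Relation.Nullary.Decidable using (⌊_⌋)
open import Relation.Binary.PropositionalEquality using (_≡_; _≢_)
open import Level using (0ℓ)

-- A quiver on vertex set Fin n, given by its (exchange) matrix:
-- f i j = number of arrows i → j, negative if the arrows go j → i.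
Quiver : ℕ → Set
Quiver n = Fin n → Fin n → ℤ

-- No loops, no 2-cycles: the matrix is skew-symmetric.
Skew : ∀ {n} → Quiver n → Set
Skew f = ∀ i j → f i j ≡ - f j i

[_]⁺ : ℤ → ℤ
[ x ]⁺ = Data.Integer._⊔_ x 0ℤ

-- Mutation at k: arrows at k reversed; for a,b ≠ k, add one arrow a → b
-- per path a → k → b and cancel 2-cycles.
mutate : ∀ {n} → Fin n → Quiver n → Quiver n
mutate k f a b with a ≟ k | b ≟ k
... | yes _ | _     = - f a b
... | no _  | yes _ = - f a b
... | no _  | no _  = f a b + [ f a k ]⁺ * [ f k b ]⁺ - [ f b k ]⁺ * [ f k a ]⁺

Abundant : ∀ {n} → Quiver n → Set
Abundant f = ∀ i j → i ≢ j → 2 ℕ.≤ ∣ f i j ∣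

data WalkIn {n} (S : Fin n → Set) (f : Quiver n) : Fin n → Fin n → Set where
  step : ∀ {a b} → S a → S b → 0ℤ < f a b → WalkIn S f a b
  cons : ∀ {a c b} → S a → 0ℤ < f a c → WalkIn S f c b → WalkIn S f a b

AcyclicOn : ∀ {n} → (Fin n → Set) → Quiver n → Set
AcyclicOn S f = ∀ a → ¬ WalkIn S f a a

AllV : ∀ {n} → Fin n → Set
AllV _ = Data.Unit.⊤ where import Data.Unit

Acyclic : ∀ {n} → Quiver n → Set
Acyclic f = AcyclicOn AllV f

Without : ∀ {n} → Fin n → Fin n → Set
Without v x = x ≢ v

IsFork : ∀ {n} → Quiver n → Fin n → Set
IsFork f r =
  Abundant f × ¬ Acyclic f ×
  (∀ i j → 0ℤ < f i r → 0ℤ < f r j → (f i r < f j i) × (f r j < f j i)) ×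
  AcyclicOn (Without r) f

-- A list L is an acyclic ordering (listed in increasing ≺ order) of the
-- full subquiver on S: it enumerates S without repetition, and every
-- arrow goes from an earlier to a later entry.
IsAcyclicOrdering : ∀ {n} → Quiver n → (Fin n → Set) → List (Fin n) → Set
IsAcyclicOrdering f S L =
  Unique L × (∀ x → (S x → x ∈ L) × (x ∈ L → S x)) ×
  (∀ p q → 0ℤ < f (lookup L p) (lookup L q) → p Fin.< q)

IsUniqueAcyclicOrdering : ∀ {n} → Quiver n → (Fin n → Set) → List (Fin n) → Set
IsUniqueAcyclicOrdering f S L =
  IsAcyclicOrdering f S L × (∀ L' → IsAcyclicOrdering f S L' → L' ≡ L)

-- Abundance and skew-symmetry make every full subquiver a tournament, so an
-- acyclic ordering is unique, and every earlier vertex has an arrow to every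
-- later one. Mutating at k = v_j keeps all arrows among the other v_i: a path
-- b → k → a next to an arrow a → b would be a cycle in F ∖ {r}. When r → k,
-- every arrow at r ends up leaving r: an arrow r → b survives because there is
-- no path b → k → r, and an arrow b → r is outweighed by the f_rk · f_kb new
-- arrows r → b, since the fork condition for b → r → k gives f_kb > f_br.
-- The case k → r is dual.
module Submission where

open import Defs
open import Data.Fin using (Fin)
open import Data.Integer using (0ℤ; _<_)
open import Data.List using (List; length; lookup; removeAt; _∷_; _++_; [_])
open import Data.Product using (_×_)
open import Data.List using ([])
open import Data.Fin as F using (zero; suc)
open import Data.Fin.Properties using (_≟_)
open import Data.Integer using (_≤_; _+_; _-_; _*_; -_; +_; +[1+_]; -[1+_]; +<+; +≤+)
import Data.Integer.Properties as ℤP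
open import Data.Integer.Solver using (module +-*-Solver)
open import Data.Nat as ℕ using (z≤n; s≤s)
import Data.Nat.Properties as ℕP
open import Data.List.Relation.Unary.All as All using (All; []; _∷_)
open import Data.List.Relation.Unary.Any as Any using (here; there)
open import Data.List.Relation.Unary.Any.Properties using (¬Any[]; lookup-index)
open import Data.List.Relation.Unary.AllPairs using (AllPairs; []; _∷_)
import Data.List.Relation.Unary.AllPairs.Properties as AllPairs
open import Data.List.Relation.Unary.Unique.Propositional using (Unique)
open import Data.List.Membership.Propositional using (_∈_)
open import Data.List.Membership.Propositional.Properties using (∈-lookup; ∈-++⁺ˡ; ∈-++⁺ʳ; ∈-++⁻)
open import Data.List.Relation.Binary.Subset.Propositional using (_⊆_)
open import Data.Product using (_,_; proj₁; proj₂)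
open import Data.Sum using (_⊎_; inj₁; inj₂)
open import Data.Empty using (⊥-elim)
open import Function using (_∘_)
open import Relation.Nullary using (¬_; yes; no)
open import Relation.Binary.PropositionalEquality using (_≡_; _≢_; refl; sym; trans; cong; cong₂; subst; module ≡-Reasoning)

[]⁺-of-pos : ∀ {x} → 0ℤ < x → [ x ]⁺ ≡ x
[]⁺-of-pos = ℤP.i≥j⇒i⊔j≡i ∘ ℤP.<⇒≤

[]⁺-of-nonpos : ∀ {x} → ¬ (0ℤ < x) → [ x ]⁺ ≡ 0ℤ
[]⁺-of-nonpos = ℤP.i≤j⇒i⊔j≡j ∘ ℤP.≮⇒≥

0≤[]⁺ : ∀ x → 0ℤ ≤ [ x ]⁺
0≤[]⁺ x = ℤP.i≤j⊔i x 0ℤ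

[]⁺*[]⁺≡0 : ∀ {x y} → ¬ (0ℤ < x × 0ℤ < y) → [ x ]⁺ * [ y ]⁺ ≡ 0ℤ
[]⁺*[]⁺≡0 {x} {y} ¬x,y>0 with ℤP._<?_ 0ℤ x | ℤP._<?_ 0ℤ y
... | yes x>0 | yes y>0 = ⊥-elim (¬x,y>0 (x>0 , y>0))
... | no x≯0  | _       = trans (cong (_* [ y ]⁺) ([]⁺-of-nonpos x≯0)) (ℤP.*-zeroˡ [ y ]⁺)
... | yes _   | no y≯0  = trans (cong ([ x ]⁺ *_) ([]⁺-of-nonpos y≯0)) (ℤP.*-zeroʳ [ x ]⁺)

0≤i*j : ∀ {i j} → 0ℤ ≤ i → 0ℤ ≤ j → 0ℤ ≤ i * j
0≤i*j {+ m} {+ n} _ _ = subst (0ℤ ≤_) (ℤP.pos-* m n) (+≤+ z≤n)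

i≤j*i : ∀ {i j} → 0ℤ ≤ i → 0ℤ < j → i ≤ j * i
i≤j*i {+ m} {+[1+ n ]} _ _ = subst (+ m ≤_) (ℤP.pos-* (ℕ.suc n) m) (+≤+ (ℕP.m≤n*m m (ℕ.suc n)))
i≤j*i {j = + 0} _ (+<+ ())

i≤i*j : ∀ {i j} → 0ℤ ≤ i → 0ℤ < j → i ≤ i * j
i≤i*j {i} {j} 0≤i 0<j = subst (i ≤_) (ℤP.*-comm j i) (i≤j*i 0≤i 0<j)

0<-i⇒¬0<i : ∀ {i} → 0ℤ < - i → ¬ (0ℤ < i)
0<-i⇒¬0<i 0<-i 0<i = ℤP.<-asym 0<-i (ℤP.neg-mono-< 0<i)

i<j⇒0<-i+j : ∀ {i j} → i < j → 0ℤ < - i + j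
i<j⇒0<-i+j {i} i<j = subst (_< - i + _) (ℤP.+-inverseˡ i) (ℤP.+-monoʳ-< (- i) i<j)

module _ {A : Set} where

  -- The second and third components of IsAcyclicOrdering, for an arbitrary relation.
  Enumerates : (A → Set) → List A → Set
  Enumerates S L = ∀ x → (S x → x ∈ L) × (x ∈ L → S x)

  Increasing : (A → A → Set) → List A → Set
  Increasing R L = ∀ p q → R (lookup L p) (lookup L q) → p F.< q

  private variable
    P S : A → Set
    R : A → A → Set
    x y : A
    L L' : List A

  increasing-tail : Increasing R (x ∷ L) → Increasing R L
  increasing-tail inc p q r = ℕP.≤-pred (inc (suc p) (suc q) r)

  no-arrow-to-head : Increasing R (y ∷ L) → x ∈ L → ¬ R x y
  no-arrow-to-head {R = R} {y = y} inc x∈L x⟶y =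
    ℕP.n≮0 (inc (suc (Any.index x∈L)) zero (subst (λ z → R z y) (lookup-index x∈L) x⟶y))

  allPairs⇒increasing : (∀ {a b} → P a → P b → R a b → ¬ R b a) →
    All P L → AllPairs R L → Increasing R L
  allPairs⇒increasing {L = _ ∷ _} asym (px ∷ _) _ zero zero x⟶x = ⊥-elim (asym px px x⟶x x⟶x)
  allPairs⇒increasing {L = _ ∷ _} asym _ _ zero (suc _) _ = s≤s z≤n
  allPairs⇒increasing {L = _ ∷ L} asym (px ∷ pL) (x⟶L ∷ _) (suc p) zero y⟶x = ⊥-elim (
    asym px (All.lookup pL (∈-lookup p)) (All.lookup x⟶L (∈-lookup p)) y⟶x)
  allPairs⇒increasing {L = _ ∷ _} asym (_ ∷ pL) (_ ∷ ap) (suc p) (suc q) r =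
    s≤s (allPairs⇒increasing asym pL ap p q r)

  increasing⇒allPairs : (∀ {a b} → a ≢ b → R a b ⊎ R b a) →
    Unique L → Increasing R L → AllPairs R L
  increasing⇒allPairs tot [] _ = []
  increasing⇒allPairs {R = R} {L = x ∷ L} tot (x∉L ∷ u) inc =
    All.tabulate head-first ∷ increasing⇒allPairs tot u (increasing-tail {R = R} inc)
    where
      head-first : ∀ {y} → y ∈ L → R x y
      head-first y∈L with tot (All.lookup x∉L y∈L)
      ... | inj₁ x⟶y = x⟶y
      ... | inj₂ y⟶x = ⊥-elim (no-arrow-to-head {R = R} inc y∈L y⟶x)

  increasing-heads : All (R x) L → Increasing R (y ∷ L') → x ∈ y ∷ L' → y ∈ x ∷ L → x ≡ y
  increasing-heads _ _ (here x≡y) _ = x≡y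
  increasing-heads _ _ (there _) (here y≡x) = sym y≡x
  increasing-heads {R = R} x⟶L inc (there x∈L') (there y∈L) =
    ⊥-elim (no-arrow-to-head {R = R} inc x∈L' (All.lookup x⟶L y∈L))

  ⊆-tail : All (x ≢_) L → L ⊆ x ∷ L' → L ⊆ L'
  ⊆-tail x∉L L⊆x∷L' z∈L = Any.tail (λ z≡x → All.lookup x∉L z∈L (sym z≡x)) (L⊆x∷L' z∈L)

  increasing-unique : AllPairs R L → Unique L → Unique L' → L ⊆ L' → L' ⊆ L →
    Increasing R L' → L' ≡ L
  increasing-unique {L = []} {L' = []} _ _ _ _ _ _ = refl
  increasing-unique {L = []} {L' = _ ∷ _} _ _ _ _ L'⊆L _ = ⊥-elim (¬Any[] (L'⊆L (here refl)))
  increasing-unique {L = _ ∷ _} {L' = []} _ _ _ L⊆L' _ _ = ⊥-elim (¬Any[] (L⊆L' (here refl)))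
  increasing-unique {R = R} {L = x ∷ L} {L' = y ∷ L'} (x⟶L ∷ ap) (x∉L ∷ u) (y∉L' ∷ u') L⊆ L'⊆ inc
    with increasing-heads {R = R} x⟶L inc (L⊆ (here refl)) (L'⊆ (here refl))
  ... | refl = cong (x ∷_) (increasing-unique ap u u'
    (⊆-tail x∉L (L⊆ ∘ there)) (⊆-tail y∉L' (L'⊆ ∘ there)) (increasing-tail {R = R} inc))

  AllPairs-∷ʳ : AllPairs R L → All (λ x → R x y) L → AllPairs R (L ++ [ y ])
  AllPairs-∷ʳ ap L⟶y = AllPairs.++⁺ ap ([] ∷ []) (All.map (_∷ []) L⟶y)

  AllPairs-map-All : {R' : A → A → Set} → (∀ {a b} → P a → P b → R a b → R' a b) →
    All P L → AllPairs R L → AllPairs R' L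
  AllPairs-map-All h [] [] = []
  AllPairs-map-All h (px ∷ pL) (x⟶L ∷ ap) =
    All.zipWith (λ (x⟶y , py) → h px py x⟶y) (x⟶L , pL) ∷ AllPairs-map-All h pL ap

  removeAt-⊆ : ∀ (xs : List A) j → removeAt xs j ⊆ xs
  removeAt-⊆ (_ ∷ _) zero x∈ = there x∈
  removeAt-⊆ (_ ∷ _) (suc j) (here x≡) = here x≡
  removeAt-⊆ (_ ∷ xs) (suc j) (there x∈) = there (removeAt-⊆ xs j x∈)

  AllPairs-removeAt : ∀ {xs} j → AllPairs R xs → AllPairs R (removeAt xs j)
  AllPairs-removeAt {xs = _ ∷ _} zero (_ ∷ ap) = ap
  AllPairs-removeAt {xs = _ ∷ xs} (suc j) (x⟶xs ∷ ap) =
    All.tabulate (All.lookup x⟶xs ∘ removeAt-⊆ xs j) ∷ AllPairs-removeAt j ap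

  ∈-removeAt⁺ : ∀ {xs} j → x ∈ xs → x ≢ lookup xs j → x ∈ removeAt xs j
  ∈-removeAt⁺ {xs = _ ∷ _} zero (here x≡y) x≢y = ⊥-elim (x≢y x≡y)
  ∈-removeAt⁺ {xs = _ ∷ _} zero (there x∈) _ = x∈
  ∈-removeAt⁺ {xs = _ ∷ _} (suc j) (here x≡y) _ = here x≡y
  ∈-removeAt⁺ {xs = _ ∷ _} (suc j) (there x∈) x≢z = there (∈-removeAt⁺ j x∈ x≢z)

  removeAt-∌-lookup : ∀ {xs} j → Unique xs → x ∈ removeAt xs j → x ≢ lookup xs j
  removeAt-∌-lookup {xs = _ ∷ _} zero (y∉xs ∷ _) x∈xs x≡y = All.lookup y∉xs x∈xs (sym x≡y)
  removeAt-∌-lookup {xs = _ ∷ _} (suc j) (y∉xs ∷ _) (here x≡y) x≡z =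
    All.lookup y∉xs (∈-lookup j) (trans (sym x≡y) x≡z)
  removeAt-∌-lookup {xs = _ ∷ _} (suc j) (_ ∷ u) (there x∈) = removeAt-∌-lookup j u x∈

  enumerates-removeAt : ∀ {xs} j → Unique xs → Enumerates S xs →
    Enumerates (λ x → S x × x ≢ lookup xs j) (removeAt xs j)
  enumerates-removeAt {xs = xs} j u enum x =
    (λ (sx , x≢y) → ∈-removeAt⁺ j (proj₁ (enum x) sx) x≢y) ,
    (λ x∈ → proj₂ (enum x) (removeAt-⊆ xs j x∈) , removeAt-∌-lookup j u x∈)

Arrow : ∀ {n} → Quiver n → Fin n → Fin n → Set
Arrow f a b = 0ℤ < f a b

module _ {n} {f : Quiver n} where

  arrow-asym : ∀ {a b} → f a b ≡ - f b a → Arrow f a b → ¬ Arrow f b a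
  arrow-asym f-ab≡ a⟶b = 0<-i⇒¬0<i (subst (0ℤ <_) f-ab≡ a⟶b)

  abundant⇒arrow-total : Skew f → Abundant f → ∀ {a b} → a ≢ b → Arrow f a b ⊎ Arrow f b a
  abundant⇒arrow-total sk ab {a} {b} a≢b with f a b | ab a b a≢b | sk b a
  ... | +[1+ _ ] | _ | _   = inj₁ (+<+ (s≤s z≤n))
  ... | -[1+ _ ] | _ | b→a = inj₂ (subst (0ℤ <_) (sym b→a) (+<+ (s≤s z≤n)))

  isAcyclicOrdering⇒allPairs : Skew f → Abundant f → ∀ {S L} →
    IsAcyclicOrdering f S L → AllPairs (Arrow f) L
  isAcyclicOrdering⇒allPairs sk ab (u , _ , inc) =
    increasing⇒allPairs (abundant⇒arrow-total sk ab) u inc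

  allPairs⇒isUniqueAcyclicOrdering : ∀ {S L} →
    (∀ {a b} → S a → S b → Arrow f a b → ¬ Arrow f b a) →
    Unique L → Enumerates S L → AllPairs (Arrow f) L → IsUniqueAcyclicOrdering f S L
  allPairs⇒isUniqueAcyclicOrdering asym u enum ap =
    (u , enum , allPairs⇒increasing asym (All.tabulate (proj₂ (enum _))) ap) ,
    λ L' (u' , enum' , inc') → increasing-unique {R = Arrow f} ap u u'
      (λ {z} → proj₁ (enum' z) ∘ proj₂ (enum z)) (λ {z} → proj₁ (enum z) ∘ proj₂ (enum' z)) inc'

  no-detour : ∀ {S a b k} → AcyclicOn S f → S a → S b → S k →
    Arrow f a b → ¬ (Arrow f b k × Arrow f k a)
  no-detour acyclic S-a S-b S-k a⟶b (b⟶k , k⟶a) =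
    acyclic _ (cons S-a a⟶b (cons S-b b⟶k (step S-k S-a k⟶a)))

  module _ {k : Fin n} {a b : Fin n} (a≢k : a ≢ k) (b≢k : b ≢ k) where

    mutate-off : mutate k f a b ≡ f a b + [ f a k ]⁺ * [ f k b ]⁺ - [ f b k ]⁺ * [ f k a ]⁺
    mutate-off with a ≟ k | b ≟ k
    ... | yes a≡k | _       = ⊥-elim (a≢k a≡k)
    ... | no _    | yes b≡k = ⊥-elim (b≢k b≡k)
    ... | no _    | no _    = refl

    mutate-arrow : ¬ (Arrow f b k × Arrow f k a) →
      0ℤ < f a b + [ f a k ]⁺ * [ f k b ]⁺ → Arrow (mutate k f) a b
    mutate-arrow no-path 0<f+p = subst (0ℤ <_) (sym mutate≡) 0<f+p
      where
        open ≡-Reasoning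
        p = [ f a k ]⁺ * [ f k b ]⁺
        mutate≡ : mutate k f a b ≡ f a b + p
        mutate≡ = begin
          mutate k f a b                          ≡⟨ mutate-off ⟩
          f a b + p - [ f b k ]⁺ * [ f k a ]⁺     ≡⟨ cong (_-_ (f a b + p)) ([]⁺*[]⁺≡0 no-path) ⟩
          f a b + p - 0ℤ                          ≡⟨ ℤP.+-identityʳ _ ⟩
          f a b + p                               ∎

    mutate-keeps-arrow : ¬ (Arrow f b k × Arrow f k a) → Arrow f a b → Arrow (mutate k f) a b
    mutate-keeps-arrow no-path a⟶b = mutate-arrow no-path
      (ℤP.+-mono-<-≤ a⟶b (0≤i*j (0≤[]⁺ (f a k)) (0≤[]⁺ (f k b))))

    mutate-creates-arrow : Skew f → Arrow f a k → Arrow f k b → f b a < f a k * f k b →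
      Arrow (mutate k f) a b
    mutate-creates-arrow sk a⟶k k⟶b f-ba<f-ak*f-kb =
      mutate-arrow (λ (_ , k⟶a) → arrow-asym (sk a k) a⟶k k⟶a)
        (subst (0ℤ <_) (sym weight≡) (i<j⇒0<-i+j f-ba<f-ak*f-kb))
      where
        weight≡ : f a b + [ f a k ]⁺ * [ f k b ]⁺ ≡ - f b a + f a k * f k b
        weight≡ = cong₂ _+_ (sk a b) (cong₂ _*_ ([]⁺-of-pos a⟶k) ([]⁺-of-pos k⟶b))

  mutate-skew-off : Skew f → ∀ {k a b} → a ≢ k → b ≢ k → mutate k f a b ≡ - mutate k f b a
  mutate-skew-off sk {k} {a} {b} a≢k b≢k = begin
    mutate k f a b                        ≡⟨ mutate-off a≢k b≢k ⟩
    f a b + p - q                         ≡⟨ cong (λ x → x + p - q) (sk a b) ⟩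
    - f b a + p - q                       ≡⟨ flip-sign (f b a) p q ⟩
    - (f b a + q - p)                     ≡⟨ cong -_ (sym (mutate-off b≢k a≢k)) ⟩
    - mutate k f b a                      ∎
    where
      open ≡-Reasoning
      p = [ f a k ]⁺ * [ f k b ]⁺
      q = [ f b k ]⁺ * [ f k a ]⁺
      flip-sign : ∀ x p q → - x + p - q ≡ - (x + q - p)
      flip-sign = solve 3 (λ x p q → :- x :+ p :- q := :- (x :+ q :- p)) refl
        where open +-*-Solver

module _ {n} {f : Quiver n} {r : Fin n} (sk : Skew f) (fork : IsFork f r)
         {k : Fin n} (k≢r : k ≢ r) where

  private
    abundant : Abundant f
    abundant = proj₁ fork

    return-condition : ∀ i j → Arrow f i r → Arrow f r j → (f i r < f j i) × (f r j < f j i)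
    return-condition = proj₁ (proj₂ (proj₂ fork))

    acyclic-without-return : AcyclicOn (Without r) f
    acyclic-without-return = proj₂ (proj₂ (proj₂ fork))

    r≢k : r ≢ k
    r≢k = k≢r ∘ sym

  arrow-from-return : Arrow f r k → ∀ {b} → b ≢ r → b ≢ k → Arrow (mutate k f) r b
  arrow-from-return r⟶k {b} b≢r b≢k with abundant⇒arrow-total sk abundant (b≢r ∘ sym)
  ... | inj₁ r⟶b = mutate-keeps-arrow r≢k b≢k (λ (_ , k⟶r) → arrow-asym {f = f} (sk r k) r⟶k k⟶r) r⟶b
  ... | inj₂ b⟶r = mutate-creates-arrow r≢k b≢k sk r⟶k k⟶b
                     (ℤP.<-≤-trans f-br<f-kb (i≤j*i (ℤP.<⇒≤ k⟶b) r⟶k))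
    where
      f-br<f-kb : f b r < f k b
      f-br<f-kb = proj₁ (return-condition b k b⟶r r⟶k)
      k⟶b : Arrow f k b
      k⟶b = ℤP.<-trans r⟶k (proj₂ (return-condition b k b⟶r r⟶k))

  arrow-to-return : Arrow f k r → ∀ {a} → a ≢ r → a ≢ k → Arrow (mutate k f) a r
  arrow-to-return k⟶r {a} a≢r a≢k with abundant⇒arrow-total sk abundant a≢r
  ... | inj₁ a⟶r = mutate-keeps-arrow a≢k r≢k (λ (r⟶k , _) → arrow-asym {f = f} (sk k r) k⟶r r⟶k) a⟶r
  ... | inj₂ r⟶a = mutate-creates-arrow a≢k r≢k sk a⟶k k⟶r
                     (ℤP.<-≤-trans f-ra<f-ak (i≤i*j (ℤP.<⇒≤ a⟶k) k⟶r))
    where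
      f-ra<f-ak : f r a < f a k
      f-ra<f-ak = proj₂ (return-condition k a k⟶r r⟶a)
      a⟶k : Arrow f a k
      a⟶k = ℤP.<-trans k⟶r (proj₁ (return-condition k a k⟶r r⟶a))

  module _ {W : List (Fin n)} (W-unique : Unique W) (W-arrows : AllPairs (Arrow f) W)
           (W-enum : Enumerates (λ x → x ≢ r × x ≢ k) W) where

    private
      W-avoids : All (λ x → x ≢ r × x ≢ k) W
      W-avoids = All.tabulate (proj₂ (W-enum _))

      mutant-asym : ∀ {a b} → a ≢ k → b ≢ k → Arrow (mutate k f) a b → ¬ Arrow (mutate k f) b a
      mutant-asym {a} {b} a≢k b≢k = arrow-asym {f = mutate k f} {a} {b} (mutate-skew-off sk a≢k b≢k)

      W-mutant-arrows : AllPairs (Arrow (mutate k f)) W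
      W-mutant-arrows = AllPairs-map-All
        (λ (a≢r , a≢k) (b≢r , b≢k) a⟶b →
          mutate-keeps-arrow a≢k b≢k (no-detour acyclic-without-return a≢r b≢r k≢r a⟶b) a⟶b)
        W-avoids W-arrows

      enumerates-with-return : ∀ {L} → (∀ {x} → x ∈ L → x ≡ r ⊎ x ∈ W) → r ∈ L → W ⊆ L →
        Enumerates (Without k) L
      enumerates-with-return {L} split r∈L W⊆L x = to , from
        where
          to : x ≢ k → x ∈ L
          to x≢k with x ≟ r
          ... | yes refl = r∈L
          ... | no x≢r = W⊆L (proj₁ (W-enum x) (x≢r , x≢k))
          from : x ∈ L → x ≢ k
          from x∈L with split x∈L
          ... | inj₁ refl = r≢k
          ... | inj₂ x∈W = proj₂ (proj₂ (W-enum x) x∈W)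

    mutate-at-target-ordering : Arrow f r k →
      IsUniqueAcyclicOrdering (mutate k f) (Without k) (r ∷ W)
    mutate-at-target-ordering r⟶k = allPairs⇒isUniqueAcyclicOrdering mutant-asym
      (All.map (λ (x≢r , _) → x≢r ∘ sym) W-avoids ∷ W-unique)
      (enumerates-with-return (λ { (here x≡r) → inj₁ x≡r ; (there x∈W) → inj₂ x∈W }) (here refl) there)
      (All.map (λ (b≢r , b≢k) → arrow-from-return r⟶k b≢r b≢k) W-avoids ∷ W-mutant-arrows)

    mutate-at-source-ordering : Arrow f k r →
      IsUniqueAcyclicOrdering (mutate k f) (Without k) (W ++ [ r ])
    mutate-at-source-ordering k⟶r = allPairs⇒isUniqueAcyclicOrdering mutant-asym
      (AllPairs-∷ʳ W-unique (All.map proj₁ W-avoids))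
      (enumerates-with-return split (∈-++⁺ʳ W (here refl)) ∈-++⁺ˡ)
      (AllPairs-∷ʳ W-mutant-arrows (All.map (λ (a≢r , a≢k) → arrow-to-return k⟶r a≢r a≢k) W-avoids))
      where
        split : ∀ {x} → x ∈ W ++ [ r ] → x ≡ r ⊎ x ∈ W
        split x∈ with ∈-++⁻ W x∈
        ... | inj₁ x∈W = inj₂ x∈W
        ... | inj₂ (here x≡r) = inj₁ x≡r

lemma3p4 : ∀ {n} (f : Quiver n) (r : Fin n) → Skew f → IsFork f r →
    (vs : List (Fin n)) → IsAcyclicOrdering f (Without r) vs →
    (j : Fin (length vs)) →
    (0ℤ < f r (lookup vs j) →
      IsUniqueAcyclicOrdering (mutate (lookup vs j) f) (Without (lookup vs j))
        (r ∷ removeAt vs j)) ×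
    (0ℤ < f (lookup vs j) r →
      IsUniqueAcyclicOrdering (mutate (lookup vs j) f) (Without (lookup vs j))
        (removeAt vs j ++ [ r ]))
lemma3p4 f r sk fork vs vs-ordering@(vs-unique , vs-enum , _) j =
  mutate-at-target-ordering sk fork k≢r W-unique W-arrows W-enum ,
  mutate-at-source-ordering sk fork k≢r W-unique W-arrows W-enum
  where
    k≢r : lookup vs j ≢ r
    k≢r = proj₂ (vs-enum (lookup vs j)) (∈-lookup j)
    W-unique : Unique (removeAt vs j)
    W-unique = AllPairs-removeAt j vs-unique
    W-arrows : AllPairs (Arrow f) (removeAt vs j)
    W-arrows = AllPairs-removeAt j (isAcyclicOrdering⇒allPairs sk (proj₁ fork) vs-ordering)
    W-enum : Enumerates (λ x → x ≢ r × x ≢ lookup vs j) (removeAt vs j)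
    W-enum = enumerates-removeAt j vs-unique vs-enum
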